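{- Let $T$ be a semistandard skew Young tableau. For any integer $m$, let $T_m$ be the collection of all boxes $(i,j)$ of $T$ whose entry is greater than $i-m$. Then $T_m$ is a semistandard skew Young tableau. Moreover, $T$ is a Littlewood–Richardson tableau if and only if for every integer $m$ the weight of $T_m$ is a weakly decreasing sequence.
   Context: Tableaux are in English position: box $(i,j)$ lies in row $i$ from the top and column $j$ from the left. A skew tableau of shape $\lambda/\mu$ is semistandard if rows weakly increase left to right and columns strictly increase top to bottom. The weight of a tableau is $(\alpha_1,\alpha_2,\dots)$ where $\alpha_p$ is the number of entries equal to $p$. The reverse reading word reads entries from top to bottom, each row right to left. A ballot sequence is a sequence of positive integers in which every initial segment contains at least as many $p$'s as $(p+1)$'s for all $p$. A Littlewood–Richardson tableau is a semistandard skew tableau whose reverse reading word is a ballot sequence. -}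

module Defs where

open import Data.Nat using (ℕ; zero; suc; _+_; _∸_; _≤_; _<_; _<ᵇ_; _≡ᵇ_)
open import Data.Integer as ℤ using (ℤ; +_)
open import Data.Bool using (Bool; true; false; if_then_else_)
open import Data.Maybe using (Maybe; just; nothing)
open import Data.Product using (_×_; _,_; Σ)
open import Data.List using (List; []; _∷_; reverse; take; map; filterᵇ; length; _++_)
open import Data.Unit using (⊤)
open import Relation.Nullary using (does)
open import Relation.Binary.PropositionalEquality using (_≡_)

-- A skew tableau is given as a list of rows (top to bottom).  Row i
-- (0-based in Agda; row i+1 in the paper) is a pair (μᵢ , r) where μᵢ is
-- the number of skipped boxes on the left and r is the list of entries of
-- the row from left to right.  So row i occupies the 0-based columns
-- μᵢ , … , μᵢ + length r - 1, and λᵢ = μᵢ + length r.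
Row : Set
Row = ℕ × List ℕ

Tableau : Set
Tableau = List Row

nth : List ℕ → ℕ → Maybe ℕ
nth []       _       = nothing
nth (x ∷ xs) zero    = just x
nth (x ∷ xs) (suc k) = nth xs k

entry : Tableau → ℕ → ℕ → Maybe ℕ
entry []              _       _ = nothing
entry ((o , r) ∷ rs)  zero    j = if j <ᵇ o then nothing else nth r (j ∸ o)
entry (_ ∷ rs)        (suc i) j = entry rs i j

-- The rows describe a skew shape λ/μ: both μ and λ are weakly decreasing
-- (with λᵢ = μᵢ + length of row i, so μ ⊆ λ automatically).
IsSkewShape : Tableau → Set
IsSkewShape []                             = ⊤
IsSkewShape ((o , r) ∷ [])                 = ⊤
IsSkewShape ((o , r) ∷ (o' , r') ∷ rs)     =
  (o' ≤ o) × (o' + length r' ≤ o + length r) × IsSkewShape ((o' , r') ∷ rs)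

PositiveEntries : Tableau → Set
PositiveEntries T = ∀ i j e → entry T i j ≡ just e → 1 ≤ e

IsSkewTableau : Tableau → Set
IsSkewTableau T = IsSkewShape T × PositiveEntries T

SemiStandard : Tableau → Set
SemiStandard T =
  (∀ i j a b → entry T i j ≡ just a → entry T i (suc j) ≡ just b → a ≤ b) ×
  (∀ i j a b → entry T i j ≡ just a → entry T (suc i) j ≡ just b → a < b)

IsSSYT : Tableau → Set
IsSSYT T = IsSkewTableau T × SemiStandard T

rowBoxes : ℕ → ℕ → List ℕ → List (ℕ × ℕ × ℕ)
rowBoxes i j []       = []
rowBoxes i j (e ∷ es) = (i , j , e) ∷ rowBoxes i (suc j) es

-- boxes in reverse reading order: rows top to bottom, each right to left
readingBoxesFrom : ℕ → Tableau → List (ℕ × ℕ × ℕ)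
readingBoxesFrom i []             = []
readingBoxesFrom i ((o , r) ∷ rs) =
  reverse (rowBoxes i o r) ++ readingBoxesFrom (suc i) rs

readingBoxes : Tableau → List (ℕ × ℕ × ℕ)
readingBoxes = readingBoxesFrom 0

entryOf : ℕ × ℕ × ℕ → ℕ
entryOf (_ , _ , e) = e

reverseReadingWord : Tableau → List ℕ
reverseReadingWord T = map entryOf (readingBoxes T)

count : ℕ → List ℕ → ℕ
count p []       = 0
count p (x ∷ xs) = if p ≡ᵇ x then suc (count p xs) else count p xs

Ballot : List ℕ → Set
Ballot w = ∀ k p → count (suc (suc p)) (take k w) ≤ count (suc p) (take k w)

IsLRTableau : Tableau → Set
IsLRTableau T = SemiStandard T × Ballot (reverseReadingWord T)

-- Membership in T_m of a box in 0-based row i with entry e: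
-- paper's row index is i+1, and the condition is  e > (i+1) - m.
inTm : ℤ → ℕ → ℕ → Bool
inTm m i e = does ((+ suc i) ℤ.- m ℤ.<? + e)

entryₘ : Tableau → ℤ → ℕ → ℕ → Maybe ℕ
entryₘ T m i j with entry T i j
... | nothing = nothing
... | just e  = if inTm m i e then just e else nothing

boxesₘ : Tableau → ℤ → List (ℕ × ℕ × ℕ)
boxesₘ T m = filterᵇ (λ { (i , _ , e) → inTm m i e }) (readingBoxes T)

weightₘ : Tableau → ℤ → ℕ → ℕ
weightₘ T m p = count p (map entryOf (boxesₘ T m))

WeaklyDecreasing : (ℕ → ℕ) → Set
WeaklyDecreasing α = ∀ p → α (suc (suc p)) ≤ α (suc p)

module Submission where

-- Whether a box of row i with entry e lies in T_m depends only on e − i,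
-- which weakly increases along the rows and strictly increases down the
-- columns of a semistandard tableau.  Hence T_m keeps a final segment of
-- every row, these segments start weakly further left going down, and T_m
-- is again a semistandard skew tableau.
--
-- In reverse reading order the boxes come row by row, each row by weakly
-- decreasing entry.  For such a word the ballot condition is equivalent to:
-- for all R and p, the p+2's in the first R+1 rows are at most as many as
-- the p+1's in the first R rows (test the ballot condition just before the
-- first p+1 of row R+1; conversely bound any prefix by the row its end lies
-- in).  When p+1+m = R+1, the entries p+1 of T_m are exactly those in the
-- first R rows and the entries p+2 those in the first R+1 rows, so this row
-- condition says precisely that every T_m has weakly decreasing weight.

open import Defs
open import Data.Integer using (ℤ)
open import Data.Product using (_×_; Σ)
open import Function.Bundles using (_⇔_)
open import Relation.Binary.PropositionalEquality using (_≡_)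

open import Algebra.Bundles using (AbelianGroup)
open import Data.Bool using (Bool; true; false; T; if_then_else_; _∧_)
open import Data.Bool.Properties using (T-∧; T-≡)
open import Data.Empty using (⊥-elim)
open import Data.Integer as ℤ using (+_; -[1+_])
import Data.Integer.Properties as ℤₚ
open import Data.List using (List; []; _∷_; _++_; take; drop; map; filterᵇ; reverse; length)
open import Data.List.Properties using (take++drop≡id; take-map; unfold-reverse; length-drop)
open import Data.List.Relation.Unary.All as All using (All; []; _∷_)
import Data.List.Relation.Unary.All.Properties as All
open import Data.List.Relation.Unary.AllPairs as AllPairs using (AllPairs; []; _∷_)
import Data.List.Relation.Unary.AllPairs.Properties as AllPairs
open import Data.List.Relation.Unary.Linked using (Linked; []; [-]; _∷_)
open import Data.List.Relation.Unary.Linked.Properties using (Linked⇒AllPairs)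
open import Data.Maybe using (Maybe; just; nothing)
open import Data.Nat
open import Data.Nat.Properties
open import Data.Product using (_,_; proj₁; proj₂; ∃)
open import Data.Product.Function.NonDependent.Propositional using (_×-⇔_)
open import Data.Sum using (_⊎_; inj₁; inj₂)
open import Data.Unit using (tt)
open import Function using (_∘_; flip)
open import Function.Bundles using (Equivalence; mk⇔)
open import Function.Construct.Composition using (_⇔-∘_)
open import Function.Construct.Identity using (⇔-id)
open import Function.Construct.Symmetry using (⇔-sym)
open import Relation.Binary.PropositionalEquality
  using (refl; sym; trans; cong; subst; subst₂; module ≡-Reasoning)
open import Relation.Nullary using (¬_; Dec; does; yes; no)
open import Relation.Nullary.Decidable using (_⊎-dec_; _×-dec_)
open import Relation.Unary using (Decidable)

open import Algebra.Properties.Group (AbelianGroup.group ℤₚ.+-0-abelianGroup)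
  using (//-rightDividesˡ; //-rightDividesʳ; \\-leftDividesˡ)

countᵇ : {A : Set} → (A → Bool) → List A → ℕ
countᵇ F []       = 0
countᵇ F (x ∷ xs) = if F x then suc (countᵇ F xs) else countᵇ F xs

module _ {A : Set} where

  countᵇ-++ : (F : A → Bool) (xs ys : List A) →
              countᵇ F (xs ++ ys) ≡ countᵇ F xs + countᵇ F ys
  countᵇ-++ F []       ys = refl
  countᵇ-++ F (x ∷ xs) ys with F x
  ... | true  = cong suc (countᵇ-++ F xs ys)
  ... | false = countᵇ-++ F xs ys

  countᵇ-take-drop : (F : A → Bool) (k : ℕ) (xs : List A) →
                     countᵇ F xs ≡ countᵇ F (take k xs) + countᵇ F (drop k xs)
  countᵇ-take-drop F k xs =
    trans (cong (countᵇ F) (sym (take++drop≡id k xs))) (countᵇ-++ F (take k xs) (drop k xs))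

  countᵇ-none : (F : A → Bool) {xs : List A} → All (λ x → ¬ T (F x)) xs → countᵇ F xs ≡ 0
  countᵇ-none F {[]}     []       = refl
  countᵇ-none F {x ∷ xs} (h ∷ hs) with F x | h
  ... | true  | h = ⊥-elim (h _)
  ... | false | _ = countᵇ-none F hs

  countᵇ-take : (F : A → Bool) (k : ℕ) (xs : List A) →
                All (λ x → ¬ T (F x)) (drop k xs) → countᵇ F xs ≡ countᵇ F (take k xs)
  countᵇ-take F k xs none = begin
    countᵇ F xs                                   ≡⟨ countᵇ-take-drop F k xs ⟩
    countᵇ F (take k xs) + countᵇ F (drop k xs)   ≡⟨ cong (_+_ (countᵇ F (take k xs))) (countᵇ-none F none) ⟩
    countᵇ F (take k xs) + 0                      ≡⟨ +-identityʳ _ ⟩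
    countᵇ F (take k xs)                          ∎
    where open ≡-Reasoning

  countᵇ-take≤ : (F : A → Bool) (k : ℕ) (xs : List A) → countᵇ F (take k xs) ≤ countᵇ F xs
  countᵇ-take≤ F k xs = ≤-trans (m≤m+n _ _) (≤-reflexive (sym (countᵇ-take-drop F k xs)))

  countᵇ-mono : (F G : A → Bool) {xs : List A} →
                All (λ x → T (F x) → T (G x)) xs → countᵇ F xs ≤ countᵇ G xs
  countᵇ-mono F G {[]}     []       = z≤n
  countᵇ-mono F G {x ∷ xs} (h ∷ hs) with F x | G x | h
  ... | true  | true  | _ = s≤s (countᵇ-mono F G hs)
  ... | true  | false | h = ⊥-elim (h _)
  ... | false | true  | _ = m≤n⇒m≤1+n (countᵇ-mono F G hs)
  ... | false | false | _ = countᵇ-mono F G hs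

  countᵇ-cong : (F G : A → Bool) (xs : List A) → (∀ x → T (F x) ⇔ T (G x)) →
                countᵇ F xs ≡ countᵇ G xs
  countᵇ-cong F G xs F⇔G = ≤-antisym
    (countᵇ-mono F G (All.universal (Equivalence.to ∘ F⇔G) xs))
    (countᵇ-mono G F (All.universal (Equivalence.from ∘ F⇔G) xs))

  countᵇ-filterᵇ : (F G : A → Bool) (xs : List A) →
                   countᵇ G (filterᵇ F xs) ≡ countᵇ (λ x → F x ∧ G x) xs
  countᵇ-filterᵇ F G []       = refl
  countᵇ-filterᵇ F G (x ∷ xs) with F x
  ... | false = countᵇ-filterᵇ F G xs
  ... | true with G x
  ...   | true  = cong suc (countᵇ-filterᵇ F G xs)
  ...   | false = countᵇ-filterᵇ F G xs

  count-map : (q : ℕ) (f : A → ℕ) (xs : List A) →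
              count q (map f xs) ≡ countᵇ (λ x → q ≡ᵇ f x) xs
  count-map q f []       = refl
  count-map q f (x ∷ xs) with q ≡ᵇ f x
  ... | true  = cong suc (count-map q f xs)
  ... | false = count-map q f xs

module _ {A : Set} where

  All-reverse : {P : A → Set} {xs : List A} → All P xs → All P (reverse xs)
  All-reverse {xs = []}     []         = []
  All-reverse {xs = x ∷ xs} (px ∷ pxs) rewrite unfold-reverse x xs = All.∷ʳ⁺ (All-reverse pxs) px

  AllPairs-reverse : {R : A → A → Set} {xs : List A} → AllPairs (flip R) xs → AllPairs R (reverse xs)
  AllPairs-reverse {xs = []}     []         = []
  AllPairs-reverse {xs = x ∷ xs} (px ∷ pxs) rewrite unfold-reverse x xs =
    AllPairs.++⁺ (AllPairs-reverse pxs) ([] ∷ []) (All.map (_∷ []) (All-reverse px))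

  downClosed-prefix : {R : A → A → Set} {P : A → Set} → Decidable P →
    (∀ {x y} → R x y → P y → P x) → ∀ {xs} → AllPairs R xs →
    ∃ λ k → All P (take k xs) × All (¬_ ∘ P) (drop k xs)
  downClosed-prefix P? closed {[]}     _ = 0 , [] , []
  downClosed-prefix P? closed {x ∷ xs} (x≺xs ∷ sorted) with P? x
  ... | yes Px with k , inside , outside ← downClosed-prefix P? closed sorted =
    suc k , Px ∷ inside , outside
  ... | no ¬Px = 0 , [] , ¬Px ∷ All.map (λ x≺y Py → ¬Px (closed x≺y Py)) x≺xs

  sorted-split : (key : A → ℕ) → ∀ k {xs} → AllPairs (λ x y → key x ≤ key y) xs →
    ∃ λ s → All (λ x → key x ≤ s) (take k xs) × All (λ x → s ≤ key x) (drop k xs)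
  sorted-split key zero    {xs}     _ = 0 , [] , All.universal (λ _ → z≤n) xs
  sorted-split key (suc k) {[]}     _ = 0 , [] , []
  sorted-split key (suc k) {x ∷ xs} (x≤xs ∷ sorted)
    with s , before , after ← sorted-split key k sorted =
    key x ⊔ s ,
    m≤m⊔n (key x) s ∷ All.map (m≤n⇒m≤o⊔n (key x)) before ,
    All.zipWith (λ (x≤y , s≤y) → ⊔-lub x≤y s≤y) (All.drop⁺ k x≤xs , after)

-- Reverse reading order and the ballot condition

Box : Set
Box = ℕ × ℕ × ℕ

row : Box → ℕ
row (i , _ , _) = i

-- The order of the reverse reading word: rows top to bottom and, within a
-- row, weakly decreasing entries (a semistandard row read right to left).
data _≼_ (b b′ : Box) : Set where
  row< : row b < row b′ → b ≼ b′
  row≡ : row b ≡ row b′ → entryOf b′ ≤ entryOf b → b ≼ b′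

≼⇒row≤ : ∀ {b b′} → b ≼ b′ → row b ≤ row b′
≼⇒row≤ (row< lt)   = <⇒≤ lt
≼⇒row≤ (row≡ eq _) = ≤-reflexive eq

hasEntry : ℕ → Box → Bool
hasEntry q b = q ≡ᵇ entryOf b

inFirstRows : ℕ → ℕ → Box → Bool
inFirstRows R q b = (row b <ᵇ R) ∧ hasEntry q b

T-hasEntry : ∀ q b → T (hasEntry q b) ⇔ entryOf b ≡ q
T-hasEntry q b = mk⇔ (sym ∘ ≡ᵇ⇒≡ q (entryOf b)) (≡⇒≡ᵇ q (entryOf b) ∘ sym)

T-inFirstRows : ∀ R q b → T (inFirstRows R q b) ⇔ (row b < R × entryOf b ≡ q)
T-inFirstRows R q b = (mk⇔ (<ᵇ⇒< (row b) R) <⇒<ᵇ ×-⇔ T-hasEntry q b) ⇔-∘ T-∧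

countInFirstRows : ℕ → ℕ → List Box → ℕ
countInFirstRows R q = countᵇ (inFirstRows R q)

countInFirstRows≤count : ∀ R q L → countInFirstRows R q L ≤ countᵇ (hasEntry q) L
countInFirstRows≤count R q L = countᵇ-mono _ _ (All.universal
  (λ b h → Equivalence.from (T-hasEntry q b) (proj₂ (Equivalence.to (T-inFirstRows R q b) h))) L)

count≤countInFirstRows : ∀ {R} q {L} → All (λ b → row b < R) L →
                         countᵇ (hasEntry q) L ≤ countInFirstRows R q L
count≤countInFirstRows q = countᵇ-mono _ _ ∘ All.map (λ {b} b<R h →
  Equivalence.from (T-inFirstRows _ q b) (b<R , Equivalence.to (T-hasEntry q b) h))

¬inFirstRows : ∀ {R} q b → R ≤ row b → ¬ T (inFirstRows R q b)
¬inFirstRows q b R≤b h = <⇒≱ (proj₁ (Equivalence.to (T-inFirstRows _ q b) h)) R≤b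

RowBallot : List Box → Set
RowBallot L = ∀ R p → countInFirstRows (suc R) (2 + p) L ≤ countInFirstRows R (suc p) L

count-take-entries : ∀ q k L →
  count q (take k (map entryOf L)) ≡ countᵇ (hasEntry q) (take k L)
count-take-entries q k L = trans (cong (count q) (take-map k L)) (count-map q entryOf (take k L))

-- The boxes read before the first entry p+1 of row R.
ReadBefore : ℕ → ℕ → Box → Set
ReadBefore R p b = row b < R ⊎ (row b ≡ R × suc p < entryOf b)

readBefore? : ∀ R p → Decidable (ReadBefore R p)
readBefore? R p b = row b <? R ⊎-dec (row b ≟ R ×-dec suc p <? entryOf b)

readBefore-closed : ∀ {R p b b′} → b ≼ b′ → ReadBefore R p b′ → ReadBefore R p b
readBefore-closed b≼b′             (inj₁ b′<R)          = inj₁ (≤-<-trans (≼⇒row≤ b≼b′) b′<R)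
readBefore-closed (row< b<b′)      (inj₂ (refl , _))    = inj₁ b<b′
readBefore-closed (row≡ b≡b′ e′≤e) (inj₂ (refl , p<e′)) = inj₂ (b≡b′ , <-≤-trans p<e′ e′≤e)

module _ {R p : ℕ} where

  ¬readBefore⇒¬inFirstRows : ∀ b → ¬ ReadBefore R p b → ¬ T (inFirstRows (suc R) (2 + p) b)
  ¬readBefore⇒¬inFirstRows b ¬before h
    with b<1+R , e≡2+p ← Equivalence.to (T-inFirstRows (suc R) (2 + p) b) h
    with m<1+n⇒m<n∨m≡n b<1+R
  ... | inj₁ b<R = ¬before (inj₁ b<R)
  ... | inj₂ b≡R = ¬before (inj₂ (b≡R , ≤-reflexive (sym e≡2+p)))

  readBefore⇒inFirstRows : ∀ b → ReadBefore R p b → T (hasEntry (suc p) b) → T (inFirstRows R (suc p) b)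
  readBefore⇒inFirstRows b (inj₁ b<R) h =
    Equivalence.from (T-inFirstRows R (suc p) b) (b<R , Equivalence.to (T-hasEntry (suc p) b) h)
  readBefore⇒inFirstRows b (inj₂ (_ , 1+p<e)) h =
    ⊥-elim (<-irrefl (sym (Equivalence.to (T-hasEntry (suc p) b) h)) 1+p<e)

module _ {L : List Box} (sorted : AllPairs _≼_ L) where

  rowBallot⇒ballot : RowBallot L → Ballot (map entryOf L)
  rowBallot⇒ballot rowBallot k p
    with s , before , after ← sorted-split row k (AllPairs.map ≼⇒row≤ sorted)
    rewrite count-take-entries (2 + p) k L | count-take-entries (suc p) k L = begin
    countᵇ (hasEntry (2 + p)) (take k L)        ≤⟨ count≤countInFirstRows (2 + p) (All.map s≤s before) ⟩
    countInFirstRows (suc s) (2 + p) (take k L) ≤⟨ countᵇ-take≤ _ k L ⟩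
    countInFirstRows (suc s) (2 + p) L          ≤⟨ rowBallot s p ⟩
    countInFirstRows s (suc p) L                ≡⟨ countᵇ-take _ k L
                                                     (All.map (λ {b} → ¬inFirstRows (suc p) b) after) ⟩
    countInFirstRows s (suc p) (take k L)       ≤⟨ countInFirstRows≤count s (suc p) (take k L) ⟩
    countᵇ (hasEntry (suc p)) (take k L)        ∎
    where open ≤-Reasoning

  ballot⇒rowBallot : Ballot (map entryOf L) → RowBallot L
  ballot⇒rowBallot ballot R p
    with k , before , after ← downClosed-prefix (readBefore? R p) (readBefore-closed {R} {p}) sorted =
    begin
    countInFirstRows (suc R) (2 + p) L          ≡⟨ countᵇ-take _ k L
                                                     (All.map (λ {b} → ¬readBefore⇒¬inFirstRows b) after) ⟩
    countInFirstRows (suc R) (2 + p) (take k L) ≤⟨ countInFirstRows≤count (suc R) (2 + p) (take k L) ⟩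
    countᵇ (hasEntry (2 + p)) (take k L)        ≡⟨ count-take-entries (2 + p) k L ⟨
    count (2 + p) (take k (map entryOf L))      ≤⟨ ballot k p ⟩
    count (suc p) (take k (map entryOf L))      ≡⟨ count-take-entries (suc p) k L ⟩
    countᵇ (hasEntry (suc p)) (take k L)        ≤⟨ countᵇ-mono _ _
                                                     (All.map (λ {b} → readBefore⇒inFirstRows b) before) ⟩
    countInFirstRows R (suc p) (take k L)       ≤⟨ countᵇ-take≤ _ k L ⟩
    countInFirstRows R (suc p) L                ∎
    where open ≤-Reasoning

-- The clause of entry for the first row: entry ((o , r) ∷ rs) 0 reduces to rowEntry o r.
rowEntry : ℕ → List ℕ → ℕ → Maybe ℕ
rowEntry o r j = if j <ᵇ o then nothing else nth r (j ∸ o)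

rowEntry-offset : ∀ o r t → rowEntry o r (o + t) ≡ nth r t
rowEntry-offset zero    r t = refl
rowEntry-offset (suc o) r t = rowEntry-offset o r t

nth-linked : ∀ r → (∀ t a b → nth r t ≡ just a → nth r (suc t) ≡ just b → a ≤ b) → Linked _≤_ r
nth-linked []          _    = []
nth-linked (x ∷ [])    _    = [-]
nth-linked (x ∷ y ∷ r) incr = incr 0 x y refl refl ∷ nth-linked (y ∷ r) (incr ∘ suc)

rows-sorted : ∀ tab → (∀ i j a b → entry tab i j ≡ just a → entry tab i (suc j) ≡ just b → a ≤ b) →
              All (AllPairs _≤_ ∘ proj₂) tab
rows-sorted []             _    = []
rows-sorted ((o , r) ∷ rs) incr =
  Linked⇒AllPairs ≤-trans (nth-linked r λ t a b atT at1+t →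
    incr 0 (o + t) a b (trans (rowEntry-offset o r t) atT)
      (trans (cong (rowEntry o r) (sym (+-suc o t))) (trans (rowEntry-offset o r (suc t)) at1+t)))
  ∷ rows-sorted rs (incr ∘ suc)

rowBoxes-All : ∀ {P : ℕ → Set} i j {r} → All P r →
               All (λ b → row b ≡ i × P (entryOf b)) (rowBoxes i j r)
rowBoxes-All i j []         = []
rowBoxes-All i j (px ∷ pxs) = (refl , px) ∷ rowBoxes-All i (suc j) pxs

rowBoxes-row : ∀ i j r → All (λ b → row b ≡ i) (rowBoxes i j r)
rowBoxes-row i j r = All.map proj₁ (rowBoxes-All i j (All.universal (λ _ → tt) r))

rowBoxes-descending : ∀ i j {r} → AllPairs _≤_ r → AllPairs (flip _≼_) (rowBoxes i j r)
rowBoxes-descending i j []             = []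
rowBoxes-descending i j (x≤r ∷ sorted) =
  All.map (λ (b≡i , x≤b) → row≡ b≡i x≤b) (rowBoxes-All i (suc j) x≤r)
  ∷ rowBoxes-descending i (suc j) sorted

readingBoxesFrom-rows : ∀ i tab → All (λ b → i ≤ row b) (readingBoxesFrom i tab)
readingBoxesFrom-rows i []             = []
readingBoxesFrom-rows i ((o , r) ∷ rs) = All.++⁺
  (All-reverse (All.map (≤-reflexive ∘ sym) (rowBoxes-row i o r)))
  (All.map (≤-trans (n≤1+n i)) (readingBoxesFrom-rows (suc i) rs))

readingBoxesFrom-sorted : ∀ i {tab} → All (AllPairs _≤_ ∘ proj₂) tab →
                          AllPairs _≼_ (readingBoxesFrom i tab)
readingBoxesFrom-sorted i {[]}           []                = []
readingBoxesFrom-sorted i {(o , r) ∷ rs} (sorted ∷ sorteds) = AllPairs.++⁺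
  (AllPairs-reverse (rowBoxes-descending i o sorted))
  (readingBoxesFrom-sorted (suc i) sorteds)
  (All-reverse (All.map (λ b≡i → All.map (λ {c} i<c → row< (subst (_< row c) (sym b≡i) i<c))
                                         (readingBoxesFrom-rows (suc i) rs))
                        (rowBoxes-row i o r)))

-- Membership in T_m and its weight

T-does : {P : Set} (P? : Dec P) → T (does P?) ⇔ P
T-does (yes p) = mk⇔ (λ _ → p) (λ _ → tt)
T-does (no ¬p) = mk⇔ (λ ()) ¬p

i-k<j⇔i<j+k : ∀ i j k → (i ℤ.- k ℤ.< j) ⇔ (i ℤ.< j ℤ.+ k)
i-k<j⇔i<j+k i j k = mk⇔
  (λ h → subst (ℤ._< j ℤ.+ k) (//-rightDividesˡ k i) (ℤₚ.+-monoˡ-< k h))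
  (λ h → subst (i ℤ.- k ℤ.<_) (//-rightDividesʳ k j) (ℤₚ.+-monoˡ-< (ℤ.- k) h))

T-inTm : ∀ m i e → T (inTm m i e) ⇔ (+ suc i ℤ.- m ℤ.< + e)
T-inTm m i e = T-does (+ suc i ℤ.- m ℤ.<? + e)

T-inTm-<+ : ∀ m i e → T (inTm m i e) ⇔ (+ suc i ℤ.< + e ℤ.+ m)
T-inTm-<+ m i e = i-k<j⇔i<j+k (+ suc i) (+ e) m ⇔-∘ T-inTm m i e

inTm-mono : ∀ m i {x y} → x ≤ y → T (inTm m i x) → T (inTm m i y)
inTm-mono m i {x} {y} x≤y h = Equivalence.from (T-inTm m i y)
  (ℤₚ.<-≤-trans (Equivalence.to (T-inTm m i x) h) (ℤ.+≤+ x≤y))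

inTm-below : ∀ m i {x y} → x < y → T (inTm m i x) → T (inTm m (suc i) y)
inTm-below m i {x} {y} x<y h = Equivalence.from (T-inTm m (suc i) y) (begin-strict
  + suc (suc i) ℤ.- m     ≡⟨ ℤₚ.+-assoc (+ 1) (+ suc i) (ℤ.- m) ⟩
  + 1 ℤ.+ (+ suc i ℤ.- m) <⟨ ℤₚ.+-monoʳ-< (+ 1) (Equivalence.to (T-inTm m i x) h) ⟩
  + suc x                 ≤⟨ ℤ.+≤+ x<y ⟩
  + y                     ∎)
  where open ℤₚ.≤-Reasoning

inTm-threshold : ∀ m q {R} i → + q ℤ.+ m ≡ + suc R → T (inTm m i q) ⇔ i < R
inTm-threshold m q i eq = mk⇔
  (λ h → s≤s⁻¹ (ℤₚ.drop‿+<+ (subst (+ suc i ℤ.<_) eq (Equivalence.to (T-inTm-<+ m i q) h))))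
  (λ i<R → Equivalence.from (T-inTm-<+ m i q) (subst (+ suc i ℤ.<_) (sym eq) (ℤ.+<+ (s≤s i<R))))

inTm-none : ∀ m q i → + q ℤ.+ m ℤ.≤ + 1 → ¬ T (inTm m i q)
inTm-none m q i q+m≤1 h =
  ℤₚ.<⇒≱ (Equivalence.to (T-inTm-<+ m i q) h) (ℤₚ.≤-trans q+m≤1 (ℤ.+≤+ (s≤s z≤n)))

inTmᵇ : ℤ → Box → Bool
inTmᵇ m (i , _ , e) = inTm m i e

T-inTmᵇ-hasEntry : ∀ m q b → T (inTmᵇ m b ∧ hasEntry q b) ⇔ (T (inTm m (row b) q) × entryOf b ≡ q)
T-inTmᵇ-hasEntry m q b@(i , j , e) = mk⇔
  (λ h → let (inT , e≡q) = Equivalence.to ((⇔-id _ ×-⇔ T-hasEntry q b) ⇔-∘ T-∧) h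
         in subst (T ∘ inTm m i) e≡q inT , e≡q)
  (λ (inT , e≡q) → Equivalence.from ((⇔-id _ ×-⇔ T-hasEntry q b) ⇔-∘ T-∧)
                     (subst (T ∘ inTm m i) (sym e≡q) inT , e≡q))

weightₘ≡countᵇ : ∀ tab m q → weightₘ tab m q ≡ countᵇ (λ b → inTmᵇ m b ∧ hasEntry q b) (readingBoxes tab)
weightₘ≡countᵇ tab m q =
  trans (count-map q entryOf (boxesₘ tab m))
    (trans (countᵇ-filterᵇ _ (hasEntry q) (readingBoxes tab))
      (countᵇ-cong _ _ (readingBoxes tab) λ { (i , j , e) → ⇔-id _ }))

weightₘ≡countInFirstRows : ∀ tab m q {R} → + q ℤ.+ m ≡ + suc R →
                           weightₘ tab m q ≡ countInFirstRows R q (readingBoxes tab)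
weightₘ≡countInFirstRows tab m q {R} eq = trans (weightₘ≡countᵇ tab m q)
  (countᵇ-cong _ _ (readingBoxes tab) λ b →
    ⇔-sym (T-inFirstRows R q b)
      ⇔-∘ ((inTm-threshold m q (row b) eq ×-⇔ ⇔-id _) ⇔-∘ T-inTmᵇ-hasEntry m q b))

weightₘ≡0 : ∀ tab m q → + q ℤ.+ m ℤ.≤ + 1 → weightₘ tab m q ≡ 0
weightₘ≡0 tab m q q+m≤1 = trans (weightₘ≡countᵇ tab m q) (countᵇ-none _ (All.universal
  (λ b → inTm-none m q (row b) q+m≤1 ∘ proj₁ ∘ Equivalence.to (T-inTmᵇ-hasEntry m q b))
  (readingBoxes tab)))

weightₘ-beyond≡0 : ∀ tab m p → + suc p ℤ.+ m ℤ.≤ + 0 → weightₘ tab m (2 + p) ≡ 0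
weightₘ-beyond≡0 tab m p 1+p+m≤0 = weightₘ≡0 tab m (2 + p)
  (subst (ℤ._≤ + 1) (sym (ℤₚ.+-assoc (+ 1) (+ suc p) m)) (ℤₚ.+-monoʳ-≤ (+ 1) 1+p+m≤0))

next-threshold : ∀ p m {R} → + suc p ℤ.+ m ≡ + suc R → + suc (suc p) ℤ.+ m ≡ + suc (suc R)
next-threshold p m eq = trans (ℤₚ.+-assoc (+ 1) (+ suc p) m) (cong (ℤ._+_ (+ 1)) eq)

rowBallot⇒weightsDecreasing : ∀ tab → RowBallot (readingBoxes tab) →
                              ∀ m → WeaklyDecreasing (weightₘ tab m)
rowBallot⇒weightsDecreasing tab rowBallot m p with + suc p ℤ.+ m in eq
... | + suc R = begin
  weightₘ tab m (2 + p)              ≡⟨ weightₘ≡countInFirstRows tab m (2 + p) (next-threshold p m eq) ⟩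
  countInFirstRows (suc R) (2 + p) L ≤⟨ rowBallot R p ⟩
  countInFirstRows R (suc p) L       ≡⟨ weightₘ≡countInFirstRows tab m (suc p) eq ⟨
  weightₘ tab m (suc p)              ∎
  where
  open ≤-Reasoning
  L = readingBoxes tab
... | + zero   = ≤-trans (≤-reflexive (weightₘ-beyond≡0 tab m p (ℤₚ.≤-reflexive eq))) z≤n
... | -[1+ _ ] = ≤-trans (≤-reflexive (weightₘ-beyond≡0 tab m p (subst (ℤ._≤ + 0) (sym eq) ℤ.-≤+))) z≤n

weightsDecreasing⇒rowBallot : ∀ tab → (∀ m → WeaklyDecreasing (weightₘ tab m)) →
                              RowBallot (readingBoxes tab)
weightsDecreasing⇒rowBallot tab decreasing R p = begin
  countInFirstRows (suc R) (2 + p) L ≡⟨ weightₘ≡countInFirstRows tab m (2 + p) (next-threshold p m eq) ⟨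
  weightₘ tab m (2 + p)              ≤⟨ decreasing m p ⟩
  weightₘ tab m (suc p)              ≡⟨ weightₘ≡countInFirstRows tab m (suc p) eq ⟩
  countInFirstRows R (suc p) L       ∎
  where
  open ≤-Reasoning
  L = readingBoxes tab
  m : ℤ
  m = ℤ.- + suc p ℤ.+ + suc R
  eq : + suc p ℤ.+ m ≡ + suc R
  eq = \\-leftDividesˡ (+ suc p) (+ suc R)

-- The tableau T_m

keepIf : (ℕ → Bool) → Maybe ℕ → Maybe ℕ
keepIf f nothing  = nothing
keepIf f (just e) = if f e then just e else nothing

keepIf-just : ∀ f x {e} → keepIf f x ≡ just e → x ≡ just e
keepIf-just f (just y) eq with f y
keepIf-just f (just y) refl | true = refl

entryₘ≡keepIf : ∀ tab m i j → entryₘ tab m i j ≡ keepIf (inTm m i) (entry tab i j)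
entryₘ≡keepIf tab m i j with entry tab i j
... | nothing = refl
... | just e  = refl

leadingRejects : (ℕ → Bool) → List ℕ → ℕ
leadingRejects f []       = 0
leadingRejects f (x ∷ xs) = if f x then 0 else suc (leadingRejects f xs)

tableauₘFrom : ℤ → ℕ → Tableau → Tableau
tableauₘFrom m i []             = []
tableauₘFrom m i ((o , r) ∷ rs) =
  (o + leadingRejects (inTm m i) r , drop (leadingRejects (inTm m i) r) r) ∷ tableauₘFrom m (suc i) rs

tableauₘ : Tableau → ℤ → Tableau
tableauₘ tab m = tableauₘFrom m 0 tab

rowEntry-[] : ∀ o j → rowEntry o [] j ≡ nothing
rowEntry-[] o j with j <ᵇ o
... | true  = refl
... | false = refl

keepIf-all : ∀ f o {r} j → All (T ∘ f) r → keepIf f (rowEntry o r j) ≡ rowEntry o r j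
keepIf-all f o j accepted with j <ᵇ o
... | true  = refl
... | false = keepIf-nth accepted (j ∸ o)
  where
  keepIf-nth : ∀ {r} → All (T ∘ f) r → ∀ t → keepIf f (nth r t) ≡ nth r t
  keepIf-nth []                       t       = refl
  keepIf-nth {x ∷ _} (fx ∷ _)        zero    with f x
  ... | true = refl
  keepIf-nth (_ ∷ accepted)          (suc t) = keepIf-nth accepted t

keepIf-rejected-head : ∀ f {x} r → ¬ T (f x) → ∀ o j →
                       keepIf f (rowEntry o (x ∷ r) j) ≡ keepIf f (rowEntry (suc o) r j)
keepIf-rejected-head f {x} r ¬fx zero zero with f x
... | false = refl
... | true  = ⊥-elim (¬fx tt)
keepIf-rejected-head f r ¬fx zero    (suc j) = refl
keepIf-rejected-head f r ¬fx (suc o) zero    = refl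
keepIf-rejected-head f r ¬fx (suc o) (suc j) = keepIf-rejected-head f r ¬fx o j

rowEntry-dropRejects : ∀ f → (∀ {x y} → x ≤ y → T (f x) → T (f y)) → ∀ o {r} → AllPairs _≤_ r → ∀ j →
  rowEntry (o + leadingRejects f r) (drop (leadingRejects f r) r) j ≡ keepIf f (rowEntry o r j)
rowEntry-dropRejects f upward o {[]} [] j rewrite +-identityʳ o | rowEntry-[] o j = refl
rowEntry-dropRejects f upward o {x ∷ r} (x≤r ∷ sorted) j with f x in fx
... | true rewrite +-identityʳ o =
  sym (keepIf-all f o j (fx′ ∷ All.map (λ x≤y → upward x≤y fx′) x≤r))
  where fx′ = Equivalence.from T-≡ fx
... | false rewrite +-suc o (leadingRejects f r) =
  trans (rowEntry-dropRejects f upward (suc o) sorted j)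
        (sym (keepIf-rejected-head f r (subst T fx) o j))

entry-tableauₘFrom : ∀ m i {tab} → All (AllPairs _≤_ ∘ proj₂) tab → ∀ k j →
  entry (tableauₘFrom m i tab) k j ≡ keepIf (inTm m (i + k)) (entry tab k j)
entry-tableauₘFrom m i {[]}           []                zero    j = refl
entry-tableauₘFrom m i {[]}           []                (suc k) j = refl
entry-tableauₘFrom m i {(o , r) ∷ rs} (sorted ∷ _)      zero    j rewrite +-identityʳ i =
  rowEntry-dropRejects (inTm m i) (inTm-mono m i) o sorted j
entry-tableauₘFrom m i {(o , r) ∷ rs} (_ ∷ sorteds)     (suc k) j rewrite +-suc i k =
  entry-tableauₘFrom m (suc i) sorteds k j

entry-tableauₘ : ∀ tab m → All (AllPairs _≤_ ∘ proj₂) tab → ∀ i j →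
                 entry (tableauₘ tab m) i j ≡ entryₘ tab m i j
entry-tableauₘ tab m sorteds i j =
  trans (entry-tableauₘFrom m 0 sorteds i j) (sym (entryₘ≡keepIf tab m i j))

leadingRejects≤length : ∀ f r → leadingRejects f r ≤ length r
leadingRejects≤length f []      = z≤n
leadingRejects≤length f (x ∷ r) with f x
... | true  = z≤n
... | false = s≤s (leadingRejects≤length f r)

leadingRejects≤ : ∀ f r {t y} → nth r t ≡ just y → T (f y) → leadingRejects f r ≤ t
leadingRejects≤ f (x ∷ r) {zero}  refl fx with f x
... | true = z≤n
leadingRejects≤ f (x ∷ r) {suc t} eq   fy with f x
... | true  = z≤n
... | false = s≤s (leadingRejects≤ f r eq fy)

leadingRejects-accepted : ∀ f r → leadingRejects f r < length r →
                          ∃ λ y → nth r (leadingRejects f r) ≡ just y × T (f y)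
leadingRejects-accepted f (x ∷ r) lt with f x in fx
... | true  = x , refl , Equivalence.from T-≡ fx
... | false = leadingRejects-accepted f r (s≤s⁻¹ lt)

nth-defined : ∀ r {t} → t < length r → ∃ λ y → nth r t ≡ just y
nth-defined (x ∷ r) {zero}  _  = x , refl
nth-defined (x ∷ r) {suc t} lt = nth-defined r (s≤s⁻¹ lt)

rowEntry-from : ∀ o r {j} → o ≤ j → rowEntry o r j ≡ nth r (j ∸ o)
rowEntry-from o r {j} o≤j =
  trans (cong (rowEntry o r) (sym (m+[n∸m]≡n o≤j))) (rowEntry-offset o r (j ∸ o))

ColumnsIncrease : Row → Row → Set
ColumnsIncrease (o , r) (o′ , r′) =
  ∀ j a b → rowEntry o r j ≡ just a → rowEntry o′ r′ j ≡ just b → a < b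

module _ {f g : ℕ → Bool} (below : ∀ {x y} → x < y → T (f x) → T (g y)) where

  leadingRejects-column : ∀ o r o′ r′ → ColumnsIncrease (o , r) (o′ , r′) →
    ∀ {a y} → o′ ≤ a → rowEntry o r a ≡ just y → T (f y) → a < o′ + length r′ →
    o′ + leadingRejects g r′ ≤ a
  leadingRejects-column o r o′ r′ column {a} o′≤a atA fy a<λ′
    with y′ , at′ ← nth-defined r′
                      (+-cancelˡ-< o′ _ _ (subst (_< o′ + length r′) (sym (m+[n∸m]≡n o′≤a)) a<λ′)) =
    begin
    o′ + leadingRejects g r′ ≤⟨ +-monoʳ-≤ o′ (leadingRejects≤ g r′ at′
                                  (below (column a _ _ atA (trans (rowEntry-from o′ r′ o′≤a) at′)) fy)) ⟩
    o′ + (a ∸ o′)            ≡⟨ m+[n∸m]≡n o′≤a ⟩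
    a                        ∎
    where open ≤-Reasoning

  leadingRejects-offsets : ∀ o r o′ r′ → ColumnsIncrease (o , r) (o′ , r′) →
    o′ ≤ o → o′ + length r′ ≤ o + length r →
    o′ + leadingRejects g r′ ≤ o + leadingRejects f r
  leadingRejects-offsets o r o′ r′ column o′≤o λ′≤λ
    with o + leadingRejects f r <? o′ + length r′
  ... | no ¬inside = ≤-trans (+-monoʳ-≤ o′ (leadingRejects≤length g r′)) (≮⇒≥ ¬inside)
  ... | yes inside
    with y , atK , fy ← leadingRejects-accepted f r (+-cancelˡ-< o _ _ (<-≤-trans inside λ′≤λ)) =
    leadingRejects-column o r o′ r′ column
      (≤-trans o′≤o (m≤m+n o _)) (trans (rowEntry-offset o r _) atK) fy inside

offset+length-drop : ∀ o k (r : List ℕ) → k ≤ length r → o + k + length (drop k r) ≡ o + length r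
offset+length-drop o k r k≤len
  rewrite length-drop k r | +-assoc o k (length r ∸ k) | m+[n∸m]≡n k≤len = refl

tableauₘFrom-shape : ∀ m i {tab} → IsSkewShape tab →
  (∀ k j a b → entry tab k j ≡ just a → entry tab (suc k) j ≡ just b → a < b) →
  IsSkewShape (tableauₘFrom m i tab)
tableauₘFrom-shape m i {[]}                          _                         _       = tt
tableauₘFrom-shape m i {(o , r) ∷ []}                _                         _       = tt
tableauₘFrom-shape m i {(o , r) ∷ (o′ , r′) ∷ rs} (o′≤o , λ′≤λ , shape) columns =
  leadingRejects-offsets (inTm-below m i) o r o′ r′ (columns 0) o′≤o λ′≤λ ,
  subst₂ _≤_ (sym (offset+length-drop o′ _ r′ (leadingRejects≤length _ r′)))
             (sym (offset+length-drop o _ r (leadingRejects≤length _ r))) λ′≤λ ,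
  tableauₘFrom-shape m (suc i) shape (columns ∘ suc)

IsSSYT-subfilling : ∀ {S tab} → IsSkewShape S →
  (∀ i j e → entry S i j ≡ just e → entry tab i j ≡ just e) → IsSSYT tab → IsSSYT S
IsSSYT-subfilling shape S⊆tab ((_ , positive) , rows , columns) =
  (shape , λ i j e → positive i j e ∘ S⊆tab i j e) ,
  (λ i j a b atJ at1+J → rows i j a b (S⊆tab i j a atJ) (S⊆tab i (suc j) b at1+J)) ,
  (λ i j a b atI at1+I → columns i j a b (S⊆tab i j a atI) (S⊆tab (suc i) j b at1+I))

tableauₘ-isSSYT : ∀ tab m → IsSSYT tab → IsSSYT (tableauₘ tab m)
tableauₘ-isSSYT tab m ssyt@((shape , _) , rows , columns) =
  IsSSYT-subfilling (tableauₘFrom-shape m 0 shape columns)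
    (λ i j e atIJ → keepIf-just (inTm m i) (entry tab i j)
       (trans (sym (entry-tableauₘFrom m 0 (rows-sorted tab rows) i j)) atIJ))
    ssyt

proposition3p2 : (T : Tableau) → IsSSYT T →
    ((m : ℤ) → Σ Tableau (λ S → IsSSYT S × (∀ i j → entry S i j ≡ entryₘ T m i j)))
    × (IsLRTableau T ⇔ ((m : ℤ) → WeaklyDecreasing (weightₘ T m)))
proposition3p2 tab ssyt@(_ , semistandard@(rows , _)) =
  (λ m → tableauₘ tab m , tableauₘ-isSSYT tab m ssyt , entry-tableauₘ tab m rowsSorted) ,
  mk⇔ (λ (_ , ballot) → rowBallot⇒weightsDecreasing tab (ballot⇒rowBallot readingSorted ballot))
      (λ decreasing → semistandard ,
         rowBallot⇒ballot readingSorted (weightsDecreasing⇒rowBallot tab decreasing))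
  where
  rowsSorted : All (AllPairs _≤_ ∘ proj₂) tab
  rowsSorted = rows-sorted tab rows

  readingSorted : AllPairs _≼_ (readingBoxes tab)
  readingSorted = readingBoxesFrom-sorted 0 rowsSorted
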